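{- For nonnegative integers $r,s,q$, \[ \sum_{\substack{\alpha_1+\cdots+\alpha_{q+1}=r\\ \alpha_i\ge0}}\rho(\alpha_1+1,\ldots,\alpha_q+1,\alpha_{q+1}+s+2) =\frac{1}{(r+s+1)!}\sum_{\substack{\alpha_1+\cdots+\alpha_{q+1}=r\\ \alpha_i\ge0}}\frac{1}{\prod_{k=1}^{q+1}(s+1+\alpha_k+\alpha_{k+1}+\cdots+\alpha_{q+1})} =\frac{\zeta^\star_{r+1}(\{1\}^q;s)}{(r+s+1)\,(r+s+1)!}. \]
   Context: The rising factorial is $(x)_0=1$, $(x)_n=x(x+1)\cdots(x+n-1)$. For nonnegative integers $\alpha_1,\ldots,\alpha_k$ with $\alpha_k\ge1$, the multiple $\rho$-value is \[ \rho(\alpha_1+1,\ldots,\alpha_k+1)=\sum_{1\le n_1<\cdots<n_k}\prod_{j=1}^{k}\frac{1}{(n_j+\alpha_1+\cdots+\alpha_{j-1})_{\alpha_j+1}}. \] For an integer $n\ge1$, an integer $m\ge 0$ and a complex parameter $s$ (not a negative integer), the truncated Hurwitz-type multiple zeta-star function is $\zeta^\star_n(\{1\}^m;s)=\sum_{1\le k_1\le\cdots\le k_m\le n}\frac{1}{(k_1+s)\cdots(k_m+s)}$ (equal to $1$ when $m=0$). -}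

module Defs where

open import Data.Nat as ℕ using (ℕ; zero; suc; _≤_; _∸_)
open import Data.Integer using (+_)
open import Data.List using (List; []; _∷_; map; concatMap; upTo; foldr)
open import Data.Product using (∃)
open import Data.Rational using (ℚ; 0ℚ; 1ℚ; _+_; _*_; _-_; _/_; ∣_∣; _<_)

Σℚ : List ℚ → ℚ
Σℚ = foldr _+_ 0ℚ

-- the list [a, a+1, ..., b] (empty if b < a)
range : ℕ → ℕ → List ℕ
range a b = map (λ i → a ℕ.+ i) (upTo (suc b ∸ a))

-- 1/n as a rational; only ever applied to positive n below (recipℕ 0 = 0 is a junk value)
recipℕ : ℕ → ℚ
recipℕ zero = 0ℚ
recipℕ (suc k) = + 1 / suc k

rf : ℕ → ℕ → ℕ
rf x zero = 1
rf x (suc n) = x ℕ.* rf (suc x) n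

-- truncated multiple rho-series: with parameters as = (α_j, ..., α_k), offset c = α_1+...+α_{j-1},
-- previous index m, sums over m < n_j < ... < n_k ≤ N of ∏ 1/(n_i + α_1+...+α_{i-1})_{α_i+1}
rhoT : List ℕ → ℕ → ℕ → ℕ → ℚ
rhoT [] c m N = 1ℚ
rhoT (a ∷ as) c m N =
  Σℚ (map (λ n → recipℕ (rf (n ℕ.+ c) (suc a)) * rhoT as (c ℕ.+ a) n N) (range (suc m) N))

-- partial sums (over n_k ≤ N) of ρ(α_1+1,...,α_k+1), given the list (α_1,...,α_k)
rhoPartial : List ℕ → ℕ → ℚ
rhoPartial αs N = rhoT αs 0 0 N

comps : ℕ → ℕ → List (List ℕ)
comps zero zero = [] ∷ []
comps zero (suc r) = []
comps (suc k) r = concatMap (λ a → map (a ∷_) (comps k (r ∸ a))) (range 0 r)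

bumpLast : ℕ → List ℕ → List ℕ
bumpLast t [] = []
bumpLast t (a ∷ []) = (a ℕ.+ t) ∷ []
bumpLast t (a ∷ b ∷ as) = a ∷ bumpLast t (b ∷ as)

sumℕ : List ℕ → ℕ
sumℕ = foldr ℕ._+_ 0

prodSuf : ℕ → List ℕ → ℕ
prodSuf s [] = 1
prodSuf s (a ∷ as) = (s ℕ.+ 1 ℕ.+ a ℕ.+ sumℕ as) ℕ.* prodSuf s as

-- zsT m l n s = Σ_{l ≤ k_1 ≤ ... ≤ k_m ≤ n} ∏ 1/(k_i + s)
zsT : ℕ → ℕ → ℕ → ℕ → ℚ
zsT zero l n s = 1ℚ
zsT (suc m) l n s = Σℚ (map (λ k → recipℕ (k ℕ.+ s) * zsT m k n s) (range l n))

-- ζ*_n({1}^m; s)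
zetaStar : ℕ → ℕ → ℕ → ℚ
zetaStar n m s = zsT m 1 n s

ConvergesTo : (ℕ → ℚ) → ℚ → Set
ConvergesTo f L = ∀ (ε : ℚ) → 0ℚ < ε → ∃ λ N → ∀ M → N ≤ M → ∣ f M - L ∣ < ε

-- Every ρ-series with parameters β_1,…,β_k (last one positive) telescopes, one summation at a
-- time, via  1/((n)_{p+1}) = (1/p)(1/(n)_p − 1/(n+1)_p),  to the closed value
--   ρ = 1 / ((∏_i (β_i + … + β_k)) · (1)_{β_1+…+β_k}).
-- Each truncated series lies below this value and misses it by at most (1 + H_N)^k/(N+1), H_N the
-- harmonic number, which tends to 0.  With β = (α_1,…,α_q,α_{q+1}+s+1) the closed values add up to
-- the middle expression.  For the last equality, splitting off α_1 gives the recursion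
-- W(q+1, r) = (1/(s+1+r)) Σ_{j≤r} W(q, j) for the sum W(q, r) of the middle expression, and the
-- truncated ζ⋆-values satisfy the same recursion after moving the last summation index to the front.
module Submission where

open import Data.Nat as ℕ using (ℕ; zero; suc; _∸_; _^_; _!; z≤n; s≤s)
import Data.Nat.Properties as ℕP
open import Data.Nat.Tactic.RingSolver using (solve-∀)
import Data.Integer as ℤ
import Data.Integer.Properties as ℤP
open import Data.Rational as ℚ using (ℚ; mkℚ; 0ℚ; 1ℚ; _+_; _*_; _-_; -_; _/_; _≤_; _<_; ∣_∣; toℚᵘ)
import Data.Rational.Properties as ℚP
open import Data.Rational.Unnormalised as ℚᵘ using (mkℚᵘ; *≡*; *≤*; *<*)
import Data.Rational.Unnormalised.Properties as ℚᵘP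
open import Data.Rational.Solver using (module +-*-Solver)
open import Data.List using (List; []; _∷_; map; length; concatMap; _++_; upTo; applyUpTo)
open import Data.List.Properties using (map-∘; map-cong)
open import Data.List.Relation.Unary.All as All using (All; []; _∷_)
import Data.List.Relation.Unary.All.Properties as AllP
open import Data.Product using (Σ; _×_; _,_; proj₁; proj₂)
open import Data.Empty using (⊥-elim)
open import Relation.Binary.PropositionalEquality
open import Relation.Nullary using (yes; no)
open import Defs

open +-*-Solver

frac : ℕ → ℕ → ℚ
frac a b = ℤ.+ a / suc b

toℚᵘ-frac : ∀ a b → toℚᵘ (frac a b) ℚᵘ.≃ mkℚᵘ (ℤ.+ a) b
toℚᵘ-frac a b = ℚP.toℚᵘ-fromℚᵘ (mkℚᵘ (ℤ.+ a) b)

pos-*-≡ : ∀ {a b c d} → a ℕ.* b ≡ c ℕ.* d → ℤ.+ a ℤ.* ℤ.+ b ≡ ℤ.+ c ℤ.* ℤ.+ d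
pos-*-≡ {a} {b} {c} {d} e = trans (sym (ℤP.pos-* a b)) (trans (cong ℤ.+_ e) (ℤP.pos-* c d))

pos-*-≤ : ∀ {a b c d} → a ℕ.* b ℕ.≤ c ℕ.* d → ℤ.+ a ℤ.* ℤ.+ b ℤ.≤ ℤ.+ c ℤ.* ℤ.+ d
pos-*-≤ {a} {b} {c} {d} e = subst₂ ℤ._≤_ (ℤP.pos-* a b) (ℤP.pos-* c d) (ℤ.+≤+ e)

pos-*-< : ∀ {a b c d} → a ℕ.* b ℕ.< c ℕ.* d → ℤ.+ a ℤ.* ℤ.+ b ℤ.< ℤ.+ c ℤ.* ℤ.+ d
pos-*-< {a} {b} {c} {d} e = subst₂ ℤ._<_ (ℤP.pos-* a b) (ℤP.pos-* c d) (ℤ.+<+ e)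

frac-≡ : ∀ a b c d → a ℕ.* suc d ≡ c ℕ.* suc b → frac a b ≡ frac c d
frac-≡ a b c d e = ℚP.fromℚᵘ-cong {mkℚᵘ (ℤ.+ a) b} {mkℚᵘ (ℤ.+ c) d} (*≡* (pos-*-≡ {a} {suc d} {c} {suc b} e))

frac-≤ : ∀ a b c d → a ℕ.* suc d ℕ.≤ c ℕ.* suc b → frac a b ≤ frac c d
frac-≤ a b c d e = ℚP.toℚᵘ-cancel-≤
  (ℚᵘP.≤-respˡ-≃ (ℚᵘP.≃-sym (toℚᵘ-frac a b))
    (ℚᵘP.≤-respʳ-≃ (ℚᵘP.≃-sym (toℚᵘ-frac c d)) (*≤* (pos-*-≤ {a} {suc d} {c} {suc b} e))))

frac-< : ∀ a b c d → a ℕ.* suc d ℕ.< c ℕ.* suc b → frac a b < frac c d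
frac-< a b c d e = ℚP.toℚᵘ-cancel-<
  (ℚᵘP.<-respˡ-≃ (ℚᵘP.≃-sym (toℚᵘ-frac a b))
    (ℚᵘP.<-respʳ-≃ (ℚᵘP.≃-sym (toℚᵘ-frac c d)) (*<* (pos-*-< {a} {suc d} {c} {suc b} e))))

frac-+ : ∀ a b c d → frac a b + frac c d ≡ frac (a ℕ.* suc d ℕ.+ c ℕ.* suc b) (d ℕ.+ b ℕ.* suc d)
frac-+ a b c d = ℚP.toℚᵘ-injective (ℚᵘP.≃-trans (ℚP.toℚᵘ-homo-+ (frac a b) (frac c d))
  (ℚᵘP.≃-trans (ℚᵘP.+-cong (toℚᵘ-frac a b) (toℚᵘ-frac c d))
    (ℚᵘP.≃-trans (*≡* (cong (ℤ._* ℤ.+ suc (d ℕ.+ b ℕ.* suc d)) numerator))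
      (ℚᵘP.≃-sym (toℚᵘ-frac (a ℕ.* suc d ℕ.+ c ℕ.* suc b) (d ℕ.+ b ℕ.* suc d))))))
  where
  numerator : ℤ.+ a ℤ.* ℤ.+ suc d ℤ.+ ℤ.+ c ℤ.* ℤ.+ suc b ≡ ℤ.+ (a ℕ.* suc d ℕ.+ c ℕ.* suc b)
  numerator = trans (cong₂ ℤ._+_ (sym (ℤP.pos-* a (suc d))) (sym (ℤP.pos-* c (suc b))))
                    (sym (ℤP.pos-+ (a ℕ.* suc d) _))

frac-* : ∀ a b c d → frac a b * frac c d ≡ frac (a ℕ.* c) (d ℕ.+ b ℕ.* suc d)
frac-* a b c d = ℚP.toℚᵘ-injective (ℚᵘP.≃-trans (ℚP.toℚᵘ-homo-* (frac a b) (frac c d))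
  (ℚᵘP.≃-trans (ℚᵘP.*-cong (toℚᵘ-frac a b) (toℚᵘ-frac c d))
    (ℚᵘP.≃-trans (*≡* (cong (ℤ._* ℤ.+ suc (d ℕ.+ b ℕ.* suc d)) (sym (ℤP.pos-* a c))))
      (ℚᵘP.≃-sym (toℚᵘ-frac (a ℕ.* c) (d ℕ.+ b ℕ.* suc d))))))

0≤1 : 0ℚ ≤ 1ℚ
0≤1 = frac-≤ 0 0 1 0 z≤n

fromℕ : ℕ → ℚ
fromℕ n = frac n 0

fromℕ-+ : ∀ a b → fromℕ (a ℕ.+ b) ≡ fromℕ a + fromℕ b
fromℕ-+ a b = sym (trans (frac-+ a 0 b 0) (frac-≡ (a ℕ.* 1 ℕ.+ b ℕ.* 1) (0 ℕ.+ 0 ℕ.* 1) (a ℕ.+ b) 0 (lemma a b)))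
  where
  lemma : ∀ a b → (a ℕ.* 1 ℕ.+ b ℕ.* 1) ℕ.* 1 ≡ (a ℕ.+ b) ℕ.* 1
  lemma = solve-∀

fromℕ-* : ∀ a b → fromℕ (a ℕ.* b) ≡ fromℕ a * fromℕ b
fromℕ-* a b = sym (frac-* a 0 b 0)

fromℕ-mono-≤ : ∀ {a b} → a ℕ.≤ b → fromℕ a ≤ fromℕ b
fromℕ-mono-≤ {a} {b} p = frac-≤ a 0 b 0 (ℕP.*-monoˡ-≤ 1 p)

0≤fromℕ : ∀ n → 0ℚ ≤ fromℕ n
0≤fromℕ n = fromℕ-mono-≤ {0} {n} z≤n

recipℕ-* : ∀ a b → recipℕ (a ℕ.* b) ≡ recipℕ a * recipℕ b
recipℕ-* zero b = sym (ℚP.*-zeroˡ (recipℕ b))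
recipℕ-* (suc a) zero = trans (cong recipℕ (ℕP.*-zeroʳ a)) (sym (ℚP.*-zeroʳ (recipℕ (suc a))))
recipℕ-* (suc a) (suc b) = sym (frac-* 1 a 1 b)

recipℕ-inverseˡ : ∀ n → recipℕ (suc n) * fromℕ (suc n) ≡ 1ℚ
recipℕ-inverseˡ n = trans (frac-* 1 n (suc n) 0) (frac-≡ (1 ℕ.* suc n) (0 ℕ.+ n ℕ.* 1) 1 0 (lemma n))
  where
  lemma : ∀ n → (1 ℕ.* suc n) ℕ.* 1 ≡ 1 ℕ.* suc (0 ℕ.+ n ℕ.* 1)
  lemma = solve-∀

recipℕ-*-cancelʳ : ∀ u v → 1 ℕ.≤ v → recipℕ (u ℕ.* v) * fromℕ v ≡ recipℕ u
recipℕ-*-cancelʳ u (suc v) _ = begin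
  recipℕ (u ℕ.* suc v) * fromℕ (suc v)       ≡⟨ cong (_* fromℕ (suc v)) (recipℕ-* u (suc v)) ⟩
  recipℕ u * recipℕ (suc v) * fromℕ (suc v)  ≡⟨ ℚP.*-assoc (recipℕ u) _ _ ⟩
  recipℕ u * (recipℕ (suc v) * fromℕ (suc v)) ≡⟨ cong (recipℕ u *_) (recipℕ-inverseˡ v) ⟩
  recipℕ u * 1ℚ                              ≡⟨ ℚP.*-identityʳ _ ⟩
  recipℕ u                                   ∎
  where open ≡-Reasoning

recipℕ-antimono-≤ : ∀ {a b} → 1 ℕ.≤ a → a ℕ.≤ b → recipℕ b ≤ recipℕ a
recipℕ-antimono-≤ {suc a} {suc b} _ p = frac-≤ 1 b 1 a (ℕP.*-monoʳ-≤ 1 p)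

0≤recipℕ : ∀ n → 0ℚ ≤ recipℕ n
0≤recipℕ zero = ℚP.≤-refl
0≤recipℕ (suc n) = frac-≤ 0 0 1 n z≤n

recipℕ≤1 : ∀ n → recipℕ n ≤ 1ℚ
recipℕ≤1 zero = 0≤1
recipℕ≤1 (suc n) = frac-≤ 1 n 1 0 (s≤s z≤n)

*-mono-≤-nonNeg : ∀ {a b c d} → 0ℚ ≤ a → 0ℚ ≤ c → a ≤ b → c ≤ d → a * c ≤ b * d
*-mono-≤-nonNeg {a} {b} {c} {d} 0≤a 0≤c a≤b c≤d =
  ℚP.≤-trans (ℚP.*-monoʳ-≤-nonNeg c {{ℚ.nonNegative 0≤c}} a≤b)
             (ℚP.*-monoˡ-≤-nonNeg b {{ℚ.nonNegative (ℚP.≤-trans 0≤a a≤b)}} c≤d)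

0≤* : ∀ {a b} → 0ℚ ≤ a → 0ℚ ≤ b → 0ℚ ≤ a * b
0≤* {a} {b} 0≤a 0≤b = subst (_≤ a * b) (ℚP.*-zeroˡ b) (ℚP.*-monoʳ-≤-nonNeg b {{ℚ.nonNegative 0≤b}} 0≤a)

≤-+-nonNeg : ∀ {x y} → 0ℚ ≤ y → x ≤ x + y
≤-+-nonNeg {x} {y} 0≤y = subst (_≤ x + y) (ℚP.+-identityʳ x) (ℚP.+-monoʳ-≤ x 0≤y)

≤-*-≥1 : ∀ {r x} → 0ℚ ≤ r → 1ℚ ≤ x → r ≤ x * r
≤-*-≥1 {r} {x} 0≤r 1≤x = subst (_≤ x * r) (ℚP.*-identityˡ r) (ℚP.*-monoʳ-≤-nonNeg r {{ℚ.nonNegative 0≤r}} 1≤x)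

-- Finite sums over ranges of naturals

sumFrom : (ℕ → ℚ) → ℕ → ℕ → ℚ
sumFrom f a zero = 0ℚ
sumFrom f a (suc n) = f a + sumFrom f (suc a) n

-- f a + … + f b; empty when b < a
sumRange : (ℕ → ℚ) → ℕ → ℕ → ℚ
sumRange f a b = sumFrom f a (suc b ∸ a)

Σℚ-applyUpTo : ∀ (f : ℕ → ℚ) (g : ℕ → ℕ) (h : ℕ → ℚ) n a →
  (∀ i → f (g i) ≡ h (a ℕ.+ i)) → Σℚ (map f (applyUpTo g n)) ≡ sumFrom h a n
Σℚ-applyUpTo f g h zero a e = refl
Σℚ-applyUpTo f g h (suc n) a e =
  cong₂ _+_ (trans (e 0) (cong h (ℕP.+-identityʳ a)))
    (Σℚ-applyUpTo f (λ i → g (suc i)) h n (suc a) (λ i → trans (e (suc i)) (cong h (ℕP.+-suc a i))))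

Σℚ-range : ∀ (f : ℕ → ℚ) a b → Σℚ (map f (range a b)) ≡ sumRange f a b
Σℚ-range f a b = trans (cong Σℚ (sym (map-∘ (upTo (suc b ∸ a)))))
  (Σℚ-applyUpTo (λ i → f (a ℕ.+ i)) (λ i → i) f (suc b ∸ a) a (λ i → refl))

sumFrom-cong : ∀ {f g} a n → (∀ i → a ℕ.≤ i → i ℕ.< a ℕ.+ n → f i ≡ g i) → sumFrom f a n ≡ sumFrom g a n
sumFrom-cong a zero e = refl
sumFrom-cong a (suc n) e = cong₂ _+_ (e a ℕP.≤-refl (ℕP.m<m+n a (s≤s z≤n)))
  (sumFrom-cong (suc a) n (λ i p q → e i (ℕP.≤-trans (ℕP.n≤1+n a) p) (subst (i ℕ.<_) (sym (ℕP.+-suc a n)) q)))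

sumFrom-mono-≤ : ∀ {f g} a n → (∀ i → a ℕ.≤ i → i ℕ.< a ℕ.+ n → f i ≤ g i) → sumFrom f a n ≤ sumFrom g a n
sumFrom-mono-≤ a zero e = ℚP.≤-refl
sumFrom-mono-≤ a (suc n) e = ℚP.+-mono-≤ (e a ℕP.≤-refl (ℕP.m<m+n a (s≤s z≤n)))
  (sumFrom-mono-≤ (suc a) n (λ i p q → e i (ℕP.≤-trans (ℕP.n≤1+n a) p) (subst (i ℕ.<_) (sym (ℕP.+-suc a n)) q)))

sumFrom-snoc : ∀ f a n → sumFrom f a (suc n) ≡ sumFrom f a n + f (a ℕ.+ n)
sumFrom-snoc f a zero = trans (ℚP.+-comm (f a) 0ℚ) (cong (0ℚ +_) (cong f (sym (ℕP.+-identityʳ a))))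
sumFrom-snoc f a (suc n) = trans (cong (f a +_) (sumFrom-snoc f (suc a) n))
  (trans (sym (ℚP.+-assoc (f a) _ _)) (cong (λ x → (f a + sumFrom f (suc a) n) + f x) (sym (ℕP.+-suc a n))))

sumFrom-++ : ∀ f a n m → sumFrom f a (n ℕ.+ m) ≡ sumFrom f a n + sumFrom f (a ℕ.+ n) m
sumFrom-++ f a zero m = trans (cong (λ x → sumFrom f x m) (sym (ℕP.+-identityʳ a))) (sym (ℚP.+-identityˡ _))
sumFrom-++ f a (suc n) m = trans (cong (f a +_) (sumFrom-++ f (suc a) n m))
  (trans (sym (ℚP.+-assoc (f a) _ _)) (cong (λ x → (f a + sumFrom f (suc a) n) + sumFrom f x m) (sym (ℕP.+-suc a n))))

sumFrom-*ˡ : ∀ f c a n → sumFrom (λ i → c * f i) a n ≡ c * sumFrom f a n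
sumFrom-*ˡ f c a zero = sym (ℚP.*-zeroʳ c)
sumFrom-*ˡ f c a (suc n) = trans (cong (c * f a +_) (sumFrom-*ˡ f c (suc a) n)) (sym (ℚP.*-distribˡ-+ c (f a) _))

sumFrom-+ : ∀ f g a n → sumFrom (λ i → f i + g i) a n ≡ sumFrom f a n + sumFrom g a n
sumFrom-+ f g a zero = refl
sumFrom-+ f g a (suc n) = trans (cong (f a + g a +_) (sumFrom-+ f g (suc a) n))
  (solve 4 (λ x y z w → (x :+ y) :+ (z :+ w) := (x :+ z) :+ (y :+ w)) refl (f a) (g a) (sumFrom f (suc a) n) (sumFrom g (suc a) n))

sumFrom-shift : ∀ f a n → sumFrom f (suc a) n ≡ sumFrom (λ i → f (suc i)) a n
sumFrom-shift f a zero = refl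
sumFrom-shift f a (suc n) = cong (f (suc a) +_) (sumFrom-shift f (suc a) n)

sumFrom-const : ∀ c a n → sumFrom (λ _ → c) a n ≡ fromℕ n * c
sumFrom-const c a zero = sym (ℚP.*-zeroˡ c)
sumFrom-const c a (suc n) = trans (cong (c +_) (sumFrom-const c (suc a) n))
  (trans (solve 2 (λ c l → c :+ l :* c := (con 1ℚ :+ l) :* c) refl c (fromℕ n))
    (cong (_* c) (sym (fromℕ-+ 1 n))))

sumFrom-reverse : ∀ g R → sumFrom (λ a → g (R ∸ a)) 0 (suc R) ≡ sumFrom g 0 (suc R)
sumFrom-reverse g zero = refl
sumFrom-reverse g (suc R) = begin
  g (suc R) + sumFrom (λ a → g (suc R ∸ a)) 1 (suc R) ≡⟨ cong (g (suc R) +_) (sumFrom-shift (λ a → g (suc R ∸ a)) 0 (suc R)) ⟩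
  g (suc R) + sumFrom (λ a → g (R ∸ a)) 0 (suc R)     ≡⟨ cong (g (suc R) +_) (sumFrom-reverse g R) ⟩
  g (suc R) + sumFrom g 0 (suc R)                     ≡⟨ ℚP.+-comm (g (suc R)) (sumFrom g 0 (suc R)) ⟩
  sumFrom g 0 (suc R) + g (suc R)                     ≡⟨ sym (sumFrom-snoc g 0 (suc R)) ⟩
  sumFrom g 0 (suc (suc R))                           ∎
  where open ≡-Reasoning

0≤sumFrom : ∀ f a n → (∀ i → 0ℚ ≤ f i) → 0ℚ ≤ sumFrom f a n
0≤sumFrom f a zero p = ℚP.≤-refl
0≤sumFrom f a (suc n) p = ℚP.+-mono-≤ (p a) (0≤sumFrom f (suc a) n p)

index≤bound : ∀ a b i → a ℕ.≤ i → i ℕ.< a ℕ.+ (suc b ∸ a) → i ℕ.≤ b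
index≤bound a b i a≤i i<end with a ℕ.≤? suc b
... | yes a≤1+b = ℕP.≤-pred (subst (i ℕ.<_) (ℕP.m+[n∸m]≡n a≤1+b) i<end)
... | no a≰1+b = ⊥-elim (ℕP.<-irrefl refl (ℕP.<-≤-trans
        (subst (i ℕ.<_) (trans (cong (a ℕ.+_) (ℕP.m≤n⇒m∸n≡0 (ℕP.≰⇒≥ a≰1+b))) (ℕP.+-identityʳ a)) i<end) a≤i))

sumRange-cong : ∀ {f g} a b → (∀ i → a ℕ.≤ i → i ℕ.≤ b → f i ≡ g i) → sumRange f a b ≡ sumRange g a b
sumRange-cong a b e = sumFrom-cong a (suc b ∸ a) (λ i p q → e i p (index≤bound a b i p q))

sumRange-mono-≤ : ∀ {f g} a b → (∀ i → a ℕ.≤ i → i ℕ.≤ b → f i ≤ g i) → sumRange f a b ≤ sumRange g a b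
sumRange-mono-≤ a b e = sumFrom-mono-≤ a (suc b ∸ a) (λ i p q → e i p (index≤bound a b i p q))

sumRange-empty : ∀ f a b → b ℕ.< a → sumRange f a b ≡ 0ℚ
sumRange-empty f a b p = cong (sumFrom f a) (ℕP.m≤n⇒m∸n≡0 p)

sumRange-snoc : ∀ f a b → a ℕ.≤ suc b → sumRange f a (suc b) ≡ sumRange f a b + f (suc b)
sumRange-snoc f a b p = trans (cong (sumFrom f a) (ℕP.+-∸-assoc 1 p))
  (trans (sumFrom-snoc f a (suc b ∸ a)) (cong (λ x → sumRange f a b + f x) (ℕP.m+[n∸m]≡n p)))

sumRange-cons : ∀ f a b → a ℕ.≤ b → sumRange f a b ≡ f a + sumRange f (suc a) b
sumRange-cons f a b p = cong (sumFrom f a) (ℕP.+-∸-assoc 1 p)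

sumRange-singleton : ∀ f a → sumRange f a a ≡ f a
sumRange-singleton f a = trans (sumRange-cons f a a ℕP.≤-refl)
  (trans (cong (f a +_) (sumRange-empty f (suc a) a ℕP.≤-refl)) (ℚP.+-identityʳ (f a)))

sumRange-split : ∀ f a m b → a ℕ.≤ suc m → m ℕ.≤ b → sumRange f a b ≡ sumRange f a m + sumRange f (suc m) b
sumRange-split f a m b p q = trans (cong (sumFrom f a) lengths)
  (trans (sumFrom-++ f a (suc m ∸ a) (b ∸ m)) (cong (λ x → sumRange f a m + sumFrom f x (b ∸ m)) (ℕP.m+[n∸m]≡n p)))
  where
  lengths : suc b ∸ a ≡ (suc m ∸ a) ℕ.+ (b ∸ m)
  lengths = trans (cong (λ x → suc x ∸ a) (sym (ℕP.m+[n∸m]≡n q))) (ℕP.+-∸-comm (b ∸ m) p)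

sumRange-*ˡ : ∀ f c a b → sumRange (λ i → c * f i) a b ≡ c * sumRange f a b
sumRange-*ˡ f c a b = sumFrom-*ˡ f c a (suc b ∸ a)

sumRange-+ : ∀ f g a b → sumRange (λ i → f i + g i) a b ≡ sumRange f a b + sumRange g a b
sumRange-+ f g a b = sumFrom-+ f g a (suc b ∸ a)

0≤sumRange : ∀ f a b → (∀ i → 0ℚ ≤ f i) → 0ℚ ≤ sumRange f a b
0≤sumRange f a b p = 0≤sumFrom f a (suc b ∸ a) p

sumRange-≤-suc : ∀ f a N → (∀ i → 0ℚ ≤ f i) → sumRange f a N ≤ sumRange f a (suc N)
sumRange-≤-suc f a N 0≤f with a ℕ.≤? suc N
... | yes a≤1+N = subst (sumRange f a N ≤_) (sym (sumRange-snoc f a N a≤1+N)) (≤-+-nonNeg (0≤f (suc N)))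
... | no a≰1+N = ℚP.≤-reflexive (trans (sumRange-empty f a N (ℕP.<-trans (ℕP.n<1+n N) (ℕP.≰⇒> a≰1+N)))
                                      (sym (sumRange-empty f a (suc N) (ℕP.≰⇒> a≰1+N))))

sumRange-monoʳ-≤ : ∀ f a {N M} → (∀ i → 0ℚ ≤ f i) → N ℕ.≤ M → sumRange f a N ≤ sumRange f a M
sumRange-monoʳ-≤ f a {N} {M} 0≤f N≤M = subst (λ K → sumRange f a N ≤ sumRange f a K) (ℕP.m+[n∸m]≡n N≤M) (extend (M ∸ N))
  where
  extend : ∀ d → sumRange f a N ≤ sumRange f a (N ℕ.+ d)
  extend zero = ℚP.≤-reflexive (cong (sumRange f a) (sym (ℕP.+-identityʳ N)))
  extend (suc d) = ℚP.≤-trans (extend d)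
    (subst (λ K → sumRange f a (N ℕ.+ d) ≤ sumRange f a K) (sym (ℕP.+-suc N d)) (sumRange-≤-suc f a (N ℕ.+ d) 0≤f))

sumRange-triangle : ∀ (G : ℕ → ℕ → ℚ) l n →
  sumRange (λ k → sumRange (G k) k n) l n ≡ sumRange (λ j → sumRange (λ k → G k j) l j) l n
sumRange-triangle G zero zero = refl
sumRange-triangle G (suc l) zero = trans (sumRange-empty _ (suc l) 0 (s≤s z≤n)) (sym (sumRange-empty _ (suc l) 0 (s≤s z≤n)))
sumRange-triangle G l (suc n) with l ℕ.≤? suc n
... | no l≰ = trans (sumRange-empty _ l (suc n) (ℕP.≰⇒> l≰)) (sym (sumRange-empty _ l (suc n) (ℕP.≰⇒> l≰)))
... | yes l≤ = begin
  sumRange (λ k → sumRange (G k) k (suc n)) l (suc n)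
    ≡⟨ sumRange-snoc _ l n l≤ ⟩
  sumRange (λ k → sumRange (G k) k (suc n)) l n + sumRange (G (suc n)) (suc n) (suc n)
    ≡⟨ cong₂ _+_ (sumRange-cong l n (λ k _ k≤n → sumRange-snoc (G k) k n (ℕP.≤-trans k≤n (ℕP.n≤1+n n))))
                 (sumRange-singleton (G (suc n)) (suc n)) ⟩
  sumRange (λ k → sumRange (G k) k n + G k (suc n)) l n + G (suc n) (suc n)
    ≡⟨ cong (_+ G (suc n) (suc n)) (sumRange-+ (λ k → sumRange (G k) k n) (λ k → G k (suc n)) l n) ⟩
  (sumRange (λ k → sumRange (G k) k n) l n + column) + G (suc n) (suc n)
    ≡⟨ cong (λ z → (z + column) + G (suc n) (suc n)) (sumRange-triangle G l n) ⟩
  (rows n + column) + G (suc n) (suc n)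
    ≡⟨ ℚP.+-assoc (rows n) _ _ ⟩
  rows n + (column + G (suc n) (suc n))
    ≡⟨ cong (rows n +_) (sym (sumRange-snoc (λ k → G k (suc n)) l n l≤)) ⟩
  rows n + sumRange (λ k → G k (suc n)) l (suc n)
    ≡⟨ sym (sumRange-snoc (λ j → sumRange (λ k → G k j) l j) l n l≤) ⟩
  rows (suc n) ∎
  where
  open ≡-Reasoning
  column = sumRange (λ k → G k (suc n)) l n
  rows = sumRange (λ j → sumRange (λ k → G k j) l j) l

-- Rising factorials and telescoping

rf-suc : ∀ x p → rf x (suc p) ≡ rf x p ℕ.* (x ℕ.+ p)
rf-suc x zero = trans (ℕP.*-identityʳ x) (sym (trans (ℕP.+-identityʳ (x ℕ.+ 0)) (ℕP.+-identityʳ x)))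
rf-suc x (suc p) = begin
  x ℕ.* rf (suc x) (suc p)               ≡⟨ cong (x ℕ.*_) (rf-suc (suc x) p) ⟩
  x ℕ.* (rf (suc x) p ℕ.* (suc x ℕ.+ p)) ≡⟨ sym (ℕP.*-assoc x _ _) ⟩
  x ℕ.* rf (suc x) p ℕ.* (suc x ℕ.+ p)   ≡⟨ cong (x ℕ.* rf (suc x) p ℕ.*_) (sym (ℕP.+-suc x p)) ⟩
  x ℕ.* rf (suc x) p ℕ.* (x ℕ.+ suc p)   ∎
  where open ≡-Reasoning

rf-+ : ∀ x a b → rf x (a ℕ.+ b) ≡ rf x a ℕ.* rf (x ℕ.+ a) b
rf-+ x zero b = trans (cong (λ y → rf y b) (sym (ℕP.+-identityʳ x))) (sym (ℕP.+-identityʳ _))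
rf-+ x (suc a) b = begin
  x ℕ.* rf (suc x) (a ℕ.+ b)                   ≡⟨ cong (x ℕ.*_) (rf-+ (suc x) a b) ⟩
  x ℕ.* (rf (suc x) a ℕ.* rf (suc x ℕ.+ a) b)  ≡⟨ sym (ℕP.*-assoc x _ _) ⟩
  x ℕ.* rf (suc x) a ℕ.* rf (suc x ℕ.+ a) b    ≡⟨ cong (λ y → x ℕ.* rf (suc x) a ℕ.* rf y b) (sym (ℕP.+-suc x a)) ⟩
  x ℕ.* rf (suc x) a ℕ.* rf (x ℕ.+ suc a) b    ∎
  where open ≡-Reasoning

rf-1≡! : ∀ n → rf 1 n ≡ n !
rf-1≡! zero = refl
rf-1≡! (suc n) = trans (rf-suc 1 n) (trans (cong (ℕ._* suc n) (rf-1≡! n)) (ℕP.*-comm (n !) (suc n)))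

1≤rf : ∀ x p → 1 ℕ.≤ x → 1 ℕ.≤ rf x p
1≤rf x zero _ = s≤s z≤n
1≤rf x (suc p) 1≤x = ℕP.*-mono-≤ 1≤x (1≤rf (suc x) p (s≤s z≤n))

x≤rf : ∀ x p → 1 ℕ.≤ x → 1 ℕ.≤ p → x ℕ.≤ rf x p
x≤rf x (suc p) _ _ = subst (ℕ._≤ x ℕ.* rf (suc x) p) (ℕP.*-identityʳ x) (ℕP.*-monoʳ-≤ x (1≤rf (suc x) p (s≤s z≤n)))

-- (x)_{p+1} = (x)_p (x + p) = x (x+1)_p, and (x + p) − x = p
recip-rf-step : ∀ x p → 1 ℕ.≤ x → 1 ℕ.≤ p →
  recipℕ p * recipℕ (rf x p) ≡ recipℕ (rf x (suc p)) + recipℕ p * recipℕ (rf (suc x) p)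
recip-rf-step x (suc p') 1≤x _ = begin
  1/p * recipℕ (rf x p)                        ≡⟨ cong (1/p *_) (sym (recipℕ-*-cancelʳ (rf x p) (x ℕ.+ p) x+p≥1)) ⟩
  1/p * (recipℕ (rf x p ℕ.* (x ℕ.+ p)) * fromℕ (x ℕ.+ p))
    ≡⟨ cong (λ z → 1/p * (recipℕ z * fromℕ (x ℕ.+ p))) (sym (rf-suc x p)) ⟩
  1/p * (R * fromℕ (x ℕ.+ p))                  ≡⟨ cong (λ z → 1/p * (R * z)) (fromℕ-+ x p) ⟩
  1/p * (R * (fromℕ x + fromℕ p))
    ≡⟨ solve 4 (λ u R a b → u :* (R :* (a :+ b)) := R :* (u :* b) :+ u :* (R :* a)) refl 1/p R (fromℕ x) (fromℕ p) ⟩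
  R * (1/p * fromℕ p) + 1/p * (R * fromℕ x)   ≡⟨ cong₂ (λ a b → R * a + 1/p * b) (recipℕ-inverseˡ p') R*x ⟩
  R * 1ℚ + 1/p * recipℕ (rf (suc x) p)         ≡⟨ cong (_+ 1/p * recipℕ (rf (suc x) p)) (ℚP.*-identityʳ R) ⟩
  R + 1/p * recipℕ (rf (suc x) p)              ∎
  where
  open ≡-Reasoning
  p = suc p'
  1/p = recipℕ p
  R = recipℕ (rf x (suc p))
  x+p≥1 : 1 ℕ.≤ x ℕ.+ p
  x+p≥1 = ℕP.≤-trans 1≤x (ℕP.m≤m+n x p)
  R*x : R * fromℕ x ≡ recipℕ (rf (suc x) p)
  R*x = trans (cong (λ z → recipℕ z * fromℕ x) (ℕP.*-comm x (rf (suc x) p))) (recipℕ-*-cancelʳ (rf (suc x) p) x 1≤x)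

sumFrom-telescope : ∀ (f g : ℕ → ℚ) a d → (∀ n → a ℕ.≤ n → g n ≡ f n + g (suc n)) →
  g a ≡ sumFrom f a d + g (a ℕ.+ d)
sumFrom-telescope f g a zero step = sym (trans (ℚP.+-identityˡ _) (cong g (ℕP.+-identityʳ a)))
sumFrom-telescope f g a (suc d) step = begin
  g a                                              ≡⟨ step a ℕP.≤-refl ⟩
  f a + g (suc a)                                  ≡⟨ cong (f a +_) (sumFrom-telescope f g (suc a) d (λ n a<n → step n (ℕP.<⇒≤ a<n))) ⟩
  f a + (sumFrom f (suc a) d + g (suc a ℕ.+ d))    ≡⟨ sym (ℚP.+-assoc (f a) _ _) ⟩
  sumFrom f a (suc d) + g (suc a ℕ.+ d)            ≡⟨ cong (λ z → sumFrom f a (suc d) + g z) (sym (ℕP.+-suc a d)) ⟩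
  sumFrom f a (suc d) + g (a ℕ.+ suc d)            ∎
  where open ≡-Reasoning

recip-rf-telescope : ∀ p c m N → 1 ℕ.≤ p → m ℕ.≤ N →
  recipℕ p * recipℕ (rf (suc m ℕ.+ c) p)
    ≡ sumRange (λ n → recipℕ (rf (n ℕ.+ c) (suc p))) (suc m) N + recipℕ p * recipℕ (rf (suc N ℕ.+ c) p)
recip-rf-telescope p c m N 1≤p m≤N =
  trans (sumFrom-telescope f g (suc m) (N ∸ m) step)
        (cong (λ z → sumRange f (suc m) N + g z) (cong suc (ℕP.m+[n∸m]≡n m≤N)))
  where
  f g : ℕ → ℚ
  f n = recipℕ (rf (n ℕ.+ c) (suc p))
  g n = recipℕ p * recipℕ (rf (n ℕ.+ c) p)
  step : ∀ n → suc m ℕ.≤ n → g n ≡ f n + g (suc n)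
  step n m<n = recip-rf-step (n ℕ.+ c) p (ℕP.≤-trans (ℕP.≤-trans (s≤s z≤n) m<n) (ℕP.m≤m+n n c)) 1≤p

recip-rf-tail≤ : ∀ p c N → 1 ℕ.≤ p → recipℕ p * recipℕ (rf (suc N ℕ.+ c) p) ≤ recipℕ (suc N)
recip-rf-tail≤ p c N 1≤p = subst (recipℕ p * recipℕ (rf (suc N ℕ.+ c) p) ≤_) (ℚP.*-identityˡ _)
  (*-mono-≤-nonNeg (0≤recipℕ p) (0≤recipℕ (rf (suc N ℕ.+ c) p)) (recipℕ≤1 p)
    (recipℕ-antimono-≤ (s≤s z≤n) (ℕP.≤-trans (ℕP.m≤m+n (suc N) c) (x≤rf (suc N ℕ.+ c) p (s≤s z≤n) 1≤p))))

-- Closed form of the ρ-series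

data PositiveSuffixSums : List ℕ → Set where
  [] : PositiveSuffixSums []
  _∷_ : ∀ {b bs} → 1 ℕ.≤ b ℕ.+ sumℕ bs → PositiveSuffixSums bs → PositiveSuffixSums (b ∷ bs)

suffixSumProd : List ℕ → ℕ
suffixSumProd [] = 1
suffixSumProd (b ∷ bs) = (b ℕ.+ sumℕ bs) ℕ.* suffixSumProd bs

-- the sum of the series rhoT βs c m N over all N
rhoLimit : List ℕ → ℕ → ℕ → ℚ
rhoLimit βs c m = recipℕ (suffixSumProd βs) * recipℕ (rf (suc m ℕ.+ c) (sumℕ βs))

rhoT-cons : ∀ b bs c m N →
  rhoT (b ∷ bs) c m N ≡ sumRange (λ n → recipℕ (rf (n ℕ.+ c) (suc b)) * rhoT bs (c ℕ.+ b) n N) (suc m) N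
rhoT-cons b bs c m N = Σℚ-range _ (suc m) N

0≤rhoT : ∀ βs c m N → 0ℚ ≤ rhoT βs c m N
0≤rhoT [] c m N = 0≤1
0≤rhoT (b ∷ bs) c m N = subst (0ℚ ≤_) (sym (rhoT-cons b bs c m N))
  (0≤sumRange _ (suc m) N (λ n → 0≤* (0≤recipℕ (rf (n ℕ.+ c) (suc b))) (0≤rhoT bs (c ℕ.+ b) n N)))

rhoT-monoʳ-≤ : ∀ βs c m N M → N ℕ.≤ M → rhoT βs c m N ≤ rhoT βs c m M
rhoT-monoʳ-≤ [] c m N M N≤M = ℚP.≤-refl
rhoT-monoʳ-≤ (b ∷ bs) c m N M N≤M = begin
  rhoT (b ∷ bs) c m N                        ≡⟨ rhoT-cons b bs c m N ⟩
  sumRange (λ n → f n * ρ N n) (suc m) N     ≤⟨ sumRange-monoʳ-≤ (λ n → f n * ρ N n) (suc m) (λ n → 0≤* (0≤f n) (0≤rhoT bs (c ℕ.+ b) n N)) N≤M ⟩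
  sumRange (λ n → f n * ρ N n) (suc m) M     ≤⟨ sumRange-mono-≤ (suc m) M (λ n _ _ → ℚP.*-monoˡ-≤-nonNeg (f n) {{ℚ.nonNegative (0≤f n)}}
                                                      (rhoT-monoʳ-≤ bs (c ℕ.+ b) n N M N≤M)) ⟩
  sumRange (λ n → f n * ρ M n) (suc m) M     ≡⟨ sym (rhoT-cons b bs c m M) ⟩
  rhoT (b ∷ bs) c m M                        ∎
  where
  open ℚP.≤-Reasoning
  f : ℕ → ℚ
  f n = recipℕ (rf (n ℕ.+ c) (suc b))
  0≤f : ∀ n → 0ℚ ≤ f n
  0≤f n = 0≤recipℕ (rf (n ℕ.+ c) (suc b))
  ρ : ℕ → ℕ → ℚ
  ρ K n = rhoT bs (c ℕ.+ b) n K

rhoLimit-cons : ∀ b bs c m → rhoLimit (b ∷ bs) c m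
  ≡ recipℕ (suffixSumProd bs) * (recipℕ (b ℕ.+ sumℕ bs) * recipℕ (rf (suc m ℕ.+ c) (b ℕ.+ sumℕ bs)))
rhoLimit-cons b bs c m =
  trans (cong (_* recipℕ (rf (suc m ℕ.+ c) (b ℕ.+ sumℕ bs))) (recipℕ-* (b ℕ.+ sumℕ bs) (suffixSumProd bs)))
        (solve 3 (λ a q r → (a :* q) :* r := q :* (a :* r)) refl (recipℕ (b ℕ.+ sumℕ bs)) (recipℕ (suffixSumProd bs)) _)

recip-rf-*-rhoLimit : ∀ b bs c n → recipℕ (rf (n ℕ.+ c) (suc b)) * rhoLimit bs (c ℕ.+ b) n
   ≡ recipℕ (suffixSumProd bs) * recipℕ (rf (n ℕ.+ c) (suc (b ℕ.+ sumℕ bs)))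
recip-rf-*-rhoLimit b bs c n = begin
  recipℕ (rf x (suc b)) * (recipℕ Q * recipℕ (rf (suc n ℕ.+ (c ℕ.+ b)) S))
    ≡⟨ solve 3 (λ a q r → a :* (q :* r) := q :* (a :* r)) refl (recipℕ (rf x (suc b))) (recipℕ Q) _ ⟩
  recipℕ Q * (recipℕ (rf x (suc b)) * recipℕ (rf (suc n ℕ.+ (c ℕ.+ b)) S))
    ≡⟨ cong (λ z → recipℕ Q * (recipℕ (rf x (suc b)) * recipℕ (rf z S))) shift ⟩
  recipℕ Q * (recipℕ (rf x (suc b)) * recipℕ (rf (x ℕ.+ suc b) S))
    ≡⟨ cong (recipℕ Q *_) (sym (recipℕ-* (rf x (suc b)) _)) ⟩
  recipℕ Q * recipℕ (rf x (suc b) ℕ.* rf (x ℕ.+ suc b) S)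
    ≡⟨ cong (λ z → recipℕ Q * recipℕ z) (sym (rf-+ x (suc b) S)) ⟩
  recipℕ Q * recipℕ (rf x (suc (b ℕ.+ S))) ∎
  where
  open ≡-Reasoning
  x = n ℕ.+ c
  S = sumℕ bs
  Q = suffixSumProd bs
  shift : suc n ℕ.+ (c ℕ.+ b) ≡ n ℕ.+ c ℕ.+ suc b
  shift = trans (cong suc (sym (ℕP.+-assoc n c b))) (sym (ℕP.+-suc (n ℕ.+ c) b))

rhoLimit-unfold : ∀ b bs c m N → 1 ℕ.≤ b ℕ.+ sumℕ bs → m ℕ.≤ N → rhoLimit (b ∷ bs) c m
  ≡ sumRange (λ n → recipℕ (rf (n ℕ.+ c) (suc b)) * rhoLimit bs (c ℕ.+ b) n) (suc m) N
    + recipℕ (suffixSumProd bs) * (recipℕ (b ℕ.+ sumℕ bs) * recipℕ (rf (suc N ℕ.+ c) (b ℕ.+ sumℕ bs)))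
rhoLimit-unfold b bs c m N 1≤p m≤N = begin
  rhoLimit (b ∷ bs) c m                                   ≡⟨ rhoLimit-cons b bs c m ⟩
  K * (recipℕ p * recipℕ (rf (suc m ℕ.+ c) p))            ≡⟨ cong (K *_) (recip-rf-telescope p c m N 1≤p m≤N) ⟩
  K * (sumRange g (suc m) N + tail)                       ≡⟨ ℚP.*-distribˡ-+ K _ _ ⟩
  K * sumRange g (suc m) N + K * tail                     ≡⟨ cong (_+ K * tail) (sym (sumRange-*ˡ g K (suc m) N)) ⟩
  sumRange (λ n → K * g n) (suc m) N + K * tail           ≡⟨ cong (_+ K * tail) (sumRange-cong (suc m) N (λ n _ _ → sym (recip-rf-*-rhoLimit b bs c n))) ⟩
  sumRange (λ n → recipℕ (rf (n ℕ.+ c) (suc b)) * rhoLimit bs (c ℕ.+ b) n) (suc m) N + K * tail ∎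
  where
  open ≡-Reasoning
  p = b ℕ.+ sumℕ bs
  K = recipℕ (suffixSumProd bs)
  tail = recipℕ p * recipℕ (rf (suc N ℕ.+ c) p)
  g : ℕ → ℚ
  g n = recipℕ (rf (n ℕ.+ c) (suc p))

rhoT≤rhoLimit : ∀ βs → PositiveSuffixSums βs → ∀ c m N → m ℕ.≤ N → rhoT βs c m N ≤ rhoLimit βs c m
rhoT≤rhoLimit [] [] c m N m≤N = ℚP.≤-refl
rhoT≤rhoLimit (b ∷ bs) (1≤p ∷ pos) c m N m≤N = begin
  rhoT (b ∷ bs) c m N                                ≡⟨ rhoT-cons b bs c m N ⟩
  sumRange (λ n → f n * rhoT bs (c ℕ.+ b) n N) (suc m) N
    ≤⟨ sumRange-mono-≤ (suc m) N (λ n _ n≤N → ℚP.*-monoˡ-≤-nonNeg (f n) {{ℚ.nonNegative (0≤recipℕ (rf (n ℕ.+ c) (suc b)))}}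
                                                 (rhoT≤rhoLimit bs pos (c ℕ.+ b) n N n≤N)) ⟩
  sumRange (λ n → f n * rhoLimit bs (c ℕ.+ b) n) (suc m) N
    ≤⟨ ≤-+-nonNeg (0≤* (0≤recipℕ (suffixSumProd bs)) (0≤* (0≤recipℕ p) (0≤recipℕ (rf (suc N ℕ.+ c) p)))) ⟩
  sumRange (λ n → f n * rhoLimit bs (c ℕ.+ b) n) (suc m) N + recipℕ (suffixSumProd bs) * (recipℕ p * recipℕ (rf (suc N ℕ.+ c) p))
    ≡⟨ sym (rhoLimit-unfold b bs c m N 1≤p m≤N) ⟩
  rhoLimit (b ∷ bs) c m ∎
  where
  open ℚP.≤-Reasoning
  p = b ℕ.+ sumℕ bs
  f : ℕ → ℚ
  f n = recipℕ (rf (n ℕ.+ c) (suc b))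

-- Convergence of the ρ-series

harmonic : ℕ → ℚ
harmonic N = sumRange recipℕ 1 N

powℚ : ℚ → ℕ → ℚ
powℚ x zero = 1ℚ
powℚ x (suc k) = x * powℚ x k

errorBound : ℕ → ℕ → ℚ
errorBound k N = powℚ (1ℚ + harmonic N) k * recipℕ (suc N)

0≤harmonic : ∀ N → 0ℚ ≤ harmonic N
0≤harmonic N = 0≤sumRange recipℕ 1 N 0≤recipℕ

1≤powℚ : ∀ {x} k → 1ℚ ≤ x → 1ℚ ≤ powℚ x k
1≤powℚ zero 1≤x = ℚP.≤-refl
1≤powℚ {x} (suc k) 1≤x = subst (_≤ x * powℚ x k) (ℚP.*-identityˡ 1ℚ) (*-mono-≤-nonNeg 0≤1 0≤1 1≤x (1≤powℚ k 1≤x))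

1≤1+harmonic : ∀ N → 1ℚ ≤ 1ℚ + harmonic N
1≤1+harmonic N = ≤-+-nonNeg (0≤harmonic N)

0≤errorBound : ∀ k N → 0ℚ ≤ errorBound k N
0≤errorBound k N = 0≤* (ℚP.≤-trans 0≤1 (1≤powℚ k (1≤1+harmonic N))) (0≤recipℕ (suc N))

errorBound-suc : ∀ k N → errorBound k N * harmonic N + recipℕ (suc N) ≤ errorBound (suc k) N
errorBound-suc k N = begin
  P * r * harmonic N + r       ≤⟨ ℚP.+-monoʳ-≤ (P * r * harmonic N) (≤-*-≥1 (0≤recipℕ (suc N)) (1≤powℚ k (1≤1+harmonic N))) ⟩
  P * r * harmonic N + P * r   ≡⟨ solve 3 (λ P r h → P :* r :* h :+ P :* r := (con 1ℚ :+ h) :* P :* r) refl P r (harmonic N) ⟩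
  errorBound (suc k) N         ∎
  where
  open ℚP.≤-Reasoning
  P = powℚ (1ℚ + harmonic N) k
  r = recipℕ (suc N)

recip-rf≤recip : ∀ i c b → 1 ℕ.≤ i → recipℕ (rf (i ℕ.+ c) (suc b)) ≤ recipℕ i
recip-rf≤recip i c b 1≤i = recipℕ-antimono-≤ 1≤i
  (ℕP.≤-trans (ℕP.m≤m+n i c) (x≤rf (i ℕ.+ c) (suc b) (ℕP.≤-trans 1≤i (ℕP.m≤m+n i c)) (s≤s z≤n)))

sum-recip-rf≤harmonic : ∀ b c m N → m ℕ.≤ N → sumRange (λ n → recipℕ (rf (n ℕ.+ c) (suc b))) (suc m) N ≤ harmonic N
sum-recip-rf≤harmonic b c m N m≤N = begin
  sumRange (λ n → recipℕ (rf (n ℕ.+ c) (suc b))) (suc m) N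
    ≤⟨ sumRange-mono-≤ (suc m) N (λ i m<i _ → recip-rf≤recip i c b (ℕP.≤-trans (s≤s z≤n) m<i)) ⟩
  sumRange recipℕ (suc m) N                           ≤⟨ ℚP.≤-trans (ℚP.≤-reflexive (sym (ℚP.+-identityˡ _)))
                                                           (ℚP.+-monoˡ-≤ _ (0≤sumRange recipℕ 1 m 0≤recipℕ)) ⟩
  sumRange recipℕ 1 m + sumRange recipℕ (suc m) N     ≡⟨ sym (sumRange-split recipℕ 1 m N (s≤s z≤n) m≤N) ⟩
  harmonic N                                          ∎
  where open ℚP.≤-Reasoning

rhoLimit≤rhoT+errorBound : ∀ βs → PositiveSuffixSums βs → ∀ c m N → m ℕ.≤ N →
  rhoLimit βs c m ≤ rhoT βs c m N + errorBound (length βs) N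
rhoLimit≤rhoT+errorBound [] [] c m N m≤N = ≤-+-nonNeg (0≤errorBound 0 N)
rhoLimit≤rhoT+errorBound (b ∷ bs) (1≤p ∷ pos) c m N m≤N = begin
  rhoLimit (b ∷ bs) c m                                  ≡⟨ rhoLimit-unfold b bs c m N 1≤p m≤N ⟩
  sumRange (λ n → f n * rhoLimit bs (c ℕ.+ b) n) (suc m) N + K * tail
    ≤⟨ ℚP.+-mono-≤ (sumRange-mono-≤ (suc m) N (λ n _ n≤N → ℚP.*-monoˡ-≤-nonNeg (f n) {{ℚ.nonNegative (0≤recipℕ (rf (n ℕ.+ c) (suc b)))}}
                                                 (rhoLimit≤rhoT+errorBound bs pos (c ℕ.+ b) n N n≤N)))
                   K*tail≤ ⟩
  sumRange (λ n → f n * (ρ n + E)) (suc m) N + r         ≡⟨ cong (_+ r) split ⟩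
  (rhoT (b ∷ bs) c m N + E * sumRange f (suc m) N) + r   ≡⟨ ℚP.+-assoc (rhoT (b ∷ bs) c m N) _ _ ⟩
  rhoT (b ∷ bs) c m N + (E * sumRange f (suc m) N + r)
    ≤⟨ ℚP.+-monoʳ-≤ (rhoT (b ∷ bs) c m N)
         (ℚP.≤-trans (ℚP.+-monoˡ-≤ r (ℚP.*-monoˡ-≤-nonNeg E {{ℚ.nonNegative (0≤errorBound (length bs) N)}} (sum-recip-rf≤harmonic b c m N m≤N)))
                     (errorBound-suc (length bs) N)) ⟩
  rhoT (b ∷ bs) c m N + errorBound (length (b ∷ bs)) N   ∎
  where
  open ℚP.≤-Reasoning
  p = b ℕ.+ sumℕ bs
  K = recipℕ (suffixSumProd bs)
  tail = recipℕ p * recipℕ (rf (suc N ℕ.+ c) p)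
  r = recipℕ (suc N)
  E = errorBound (length bs) N
  f ρ : ℕ → ℚ
  f n = recipℕ (rf (n ℕ.+ c) (suc b))
  ρ n = rhoT bs (c ℕ.+ b) n N
  K*tail≤ : K * tail ≤ r
  K*tail≤ = ℚP.≤-trans (ℚP.*-monoˡ-≤-nonNeg K {{ℚ.nonNegative (0≤recipℕ (suffixSumProd bs))}} (recip-rf-tail≤ p c N 1≤p))
              (ℚP.≤-trans (ℚP.*-monoʳ-≤-nonNeg r {{ℚ.nonNegative (0≤recipℕ (suc N))}} (recipℕ≤1 (suffixSumProd bs)))
                (ℚP.≤-reflexive (ℚP.*-identityˡ r)))
  split : sumRange (λ n → f n * (ρ n + E)) (suc m) N ≡ rhoT (b ∷ bs) c m N + E * sumRange f (suc m) N
  split = begin-equality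
    sumRange (λ n → f n * (ρ n + E)) (suc m) N
      ≡⟨ sumRange-cong (suc m) N (λ n _ _ → trans (ℚP.*-distribˡ-+ (f n) (ρ n) E) (cong (f n * ρ n +_) (ℚP.*-comm (f n) E))) ⟩
    sumRange (λ n → f n * ρ n + E * f n) (suc m) N
      ≡⟨ sumRange-+ (λ n → f n * ρ n) (λ n → E * f n) (suc m) N ⟩
    sumRange (λ n → f n * ρ n) (suc m) N + sumRange (λ n → E * f n) (suc m) N
      ≡⟨ cong₂ _+_ (sym (rhoT-cons b bs c m N)) (sumRange-*ˡ f E (suc m) N) ⟩
    rhoT (b ∷ bs) c m N + E * sumRange f (suc m) N ∎

recip-block≤ : ∀ a b t → b ∸ a ℕ.≤ t ℕ.* suc a → sumRange recipℕ (suc a) b ≤ fromℕ t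
recip-block≤ a b t h = begin
  sumRange recipℕ (suc a) b                    ≤⟨ sumRange-mono-≤ {g = λ _ → recipℕ (suc a)} (suc a) b (λ i a<i _ → recipℕ-antimono-≤ (s≤s z≤n) a<i) ⟩
  sumFrom (λ _ → recipℕ (suc a)) (suc a) (b ∸ a) ≡⟨ sumFrom-const (recipℕ (suc a)) (suc a) (b ∸ a) ⟩
  fromℕ (b ∸ a) * recipℕ (suc a)               ≡⟨ frac-* (b ∸ a) 0 1 a ⟩
  frac ((b ∸ a) ℕ.* 1) (a ℕ.+ 0 ℕ.* suc a)     ≤⟨ frac-≤ ((b ∸ a) ℕ.* 1) (a ℕ.+ 0 ℕ.* suc a) t 0 cross ⟩
  fromℕ t                                      ∎
  where
  open ℚP.≤-Reasoning
  cross : (b ∸ a) ℕ.* 1 ℕ.* 1 ℕ.≤ t ℕ.* suc (a ℕ.+ 0 ℕ.* suc a)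
  cross = subst₂ ℕ._≤_ (sym (trans (ℕP.*-identityʳ _) (ℕP.*-identityʳ (b ∸ a))))
            (cong (λ z → t ℕ.* suc z) (sym (ℕP.+-identityʳ a))) h

-- each block t^j < i ≤ t^{j+1} contributes at most t
harmonic-^≤ : ∀ t j → 1 ℕ.≤ t → harmonic (t ^ j) ≤ fromℕ (1 ℕ.+ j ℕ.* t)
harmonic-^≤ t zero 1≤t = ℚP.≤-refl
harmonic-^≤ t (suc j) 1≤t = begin
  harmonic (t ^ suc j)                                   ≡⟨ sumRange-split recipℕ 1 (t ^ j) (t ^ suc j) (s≤s z≤n) t^j≤t^[1+j] ⟩
  harmonic (t ^ j) + sumRange recipℕ (suc (t ^ j)) (t ^ suc j)
    ≤⟨ ℚP.+-mono-≤ (harmonic-^≤ t j 1≤t)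
         (recip-block≤ (t ^ j) (t ^ suc j) t (ℕP.≤-trans (ℕP.m∸n≤m (t ℕ.* t ^ j) (t ^ j)) (ℕP.*-monoʳ-≤ t (ℕP.n≤1+n (t ^ j))))) ⟩
  fromℕ (1 ℕ.+ j ℕ.* t) + fromℕ t                        ≡⟨ sym (fromℕ-+ (1 ℕ.+ j ℕ.* t) t) ⟩
  fromℕ (1 ℕ.+ j ℕ.* t ℕ.+ t)                            ≡⟨ cong fromℕ (lemma j t) ⟩
  fromℕ (1 ℕ.+ suc j ℕ.* t)                              ∎
  where
  open ℚP.≤-Reasoning
  t^j≤t^[1+j] : t ^ j ℕ.≤ t ^ suc j
  t^j≤t^[1+j] = subst (ℕ._≤ t ℕ.* t ^ j) (ℕP.*-identityˡ (t ^ j)) (ℕP.*-monoˡ-≤ (t ^ j) 1≤t)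
  lemma : ∀ j t → 1 ℕ.+ j ℕ.* t ℕ.+ t ≡ 1 ℕ.+ (1 ℕ.+ j) ℕ.* t
  lemma = solve-∀

powℚ-mono-≤ : ∀ {x y} k → 0ℚ ≤ x → x ≤ y → powℚ x k ≤ powℚ y k
powℚ-mono-≤ zero 0≤x x≤y = ℚP.≤-refl
powℚ-mono-≤ {x} {y} (suc k) 0≤x x≤y = *-mono-≤-nonNeg 0≤x (0≤powℚ k) x≤y (powℚ-mono-≤ k 0≤x x≤y)
  where
  0≤powℚ : ∀ k → 0ℚ ≤ powℚ x k
  0≤powℚ zero = 0≤1
  0≤powℚ (suc k) = 0≤* 0≤x (0≤powℚ k)

powℚ-fromℕ : ∀ a k → powℚ (fromℕ a) k ≡ fromℕ (a ^ k)
powℚ-fromℕ a zero = refl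
powℚ-fromℕ a (suc k) = trans (cong (fromℕ a *_) (powℚ-fromℕ a k)) (sym (fromℕ-* a (a ^ k)))

^-distribʳ-* : ∀ x y k → (x ℕ.* y) ^ k ≡ x ^ k ℕ.* y ^ k
^-distribʳ-* x y zero = refl
^-distribʳ-* x y (suc k) = trans (cong (x ℕ.* y ℕ.*_) (^-distribʳ-* x y k)) (lemma x y (x ^ k) (y ^ k))
  where
  lemma : ∀ x y a b → x ℕ.* y ℕ.* (a ℕ.* b) ≡ x ℕ.* a ℕ.* (y ℕ.* b)
  lemma = solve-∀

recip≤pos : ∀ ε → 0ℚ < ε → Σ ℕ (λ d → recipℕ (suc d) ≤ ε)
recip≤pos (mkℚ (ℤ.+ suc n) d _) _ = d , ℚP.toℚᵘ-cancel-≤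
  (ℚᵘP.≤-respˡ-≃ (ℚᵘP.≃-sym (toℚᵘ-frac 1 d)) (*≤* (pos-*-≤ {1} {suc d} {suc n} {suc d} (ℕP.*-monoˡ-≤ (suc d) {1} {suc n} (s≤s z≤n)))))
recip≤pos (mkℚ (ℤ.+ zero) d _) (ℚ.*<* (ℤ.+<+ ()))
recip≤pos (mkℚ ℤ.-[1+ n ] d _) (ℚ.*<* ())

fromℕ*recip<recip : ∀ Y N d → Y ℕ.* suc d ℕ.< suc N → fromℕ Y * recipℕ (suc N) < recipℕ (suc d)
fromℕ*recip<recip Y N d h = subst (_< recipℕ (suc d)) (sym (frac-* Y 0 1 N))
  (frac-< (Y ℕ.* 1) (N ℕ.+ 0 ℕ.* suc N) 1 d (subst₂ ℕ._<_ (cong (ℕ._* suc d) (sym (ℕP.*-identityʳ Y))) (lemma N) h))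
  where
  lemma : ∀ N → suc N ≡ 1 ℕ.* suc (N ℕ.+ 0 ℕ.* suc N)
  lemma = solve-∀

-- N = t^{k+1} with t = 1 + C (k+3)^k (d+1), where 1/(d+1) ≤ ε: then 1 + H_N ≤ (k+3) t and
-- C ((k+3) t)^k (d+1) < t^{k+1}
errorBound-small : ∀ C k ε → 0ℚ < ε → Σ ℕ (λ N → fromℕ C * errorBound k N < ε)
errorBound-small C k ε 0<ε = N , ℚP.<-≤-trans (ℚP.≤-<-trans bound (fromℕ*recip<recip (C ℕ.* X) N d CX<N)) 1/[1+d]≤ε
  where
  d = proj₁ (recip≤pos ε 0<ε)
  1/[1+d]≤ε = proj₂ (recip≤pos ε 0<ε)
  j = suc k
  A = C ℕ.* (j ℕ.+ 2) ^ k ℕ.* suc d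
  t = suc A
  N = t ^ j
  X = ((j ℕ.+ 2) ℕ.* t) ^ k
  1+H≤ : 1ℚ + harmonic N ≤ fromℕ ((j ℕ.+ 2) ℕ.* t)
  1+H≤ = ℚP.≤-trans (ℚP.+-monoʳ-≤ 1ℚ (harmonic-^≤ t j (s≤s z≤n)))
           (ℚP.≤-trans (ℚP.≤-reflexive (sym (fromℕ-+ 1 (1 ℕ.+ j ℕ.* t))))
             (fromℕ-mono-≤ (subst (ℕ._≤ (j ℕ.+ 2) ℕ.* t) (lemma j t)
               (subst (j ℕ.* t ℕ.+ 2 ℕ.≤_) (sym (ℕP.*-distribʳ-+ t j 2)) (ℕP.+-monoʳ-≤ (j ℕ.* t) (ℕP.*-monoʳ-≤ 2 (s≤s z≤n)))))))
    where
    lemma : ∀ j t → j ℕ.* t ℕ.+ 2 ≡ 1 ℕ.+ (1 ℕ.+ j ℕ.* t)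
    lemma = solve-∀
  bound : fromℕ C * errorBound k N ≤ fromℕ (C ℕ.* X) * recipℕ (suc N)
  bound = begin
    fromℕ C * (powℚ (1ℚ + harmonic N) k * recipℕ (suc N))
      ≤⟨ ℚP.*-monoˡ-≤-nonNeg (fromℕ C) {{ℚ.nonNegative (0≤fromℕ C)}}
           (ℚP.*-monoʳ-≤-nonNeg (recipℕ (suc N)) {{ℚ.nonNegative (0≤recipℕ (suc N))}}
             (powℚ-mono-≤ k (ℚP.≤-trans 0≤1 (1≤1+harmonic N)) 1+H≤)) ⟩
    fromℕ C * (powℚ (fromℕ ((j ℕ.+ 2) ℕ.* t)) k * recipℕ (suc N))
      ≡⟨ cong (λ z → fromℕ C * (z * recipℕ (suc N))) (powℚ-fromℕ ((j ℕ.+ 2) ℕ.* t) k) ⟩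
    fromℕ C * (fromℕ X * recipℕ (suc N))  ≡⟨ sym (ℚP.*-assoc (fromℕ C) (fromℕ X) (recipℕ (suc N))) ⟩
    fromℕ C * fromℕ X * recipℕ (suc N)    ≡⟨ cong (_* recipℕ (suc N)) (sym (fromℕ-* C X)) ⟩
    fromℕ (C ℕ.* X) * recipℕ (suc N)      ∎
    where open ℚP.≤-Reasoning
  CX<N : C ℕ.* X ℕ.* suc d ℕ.< suc N
  CX<N = begin-strict
    C ℕ.* X ℕ.* suc d                               ≡⟨ cong (λ z → C ℕ.* z ℕ.* suc d) (^-distribʳ-* (j ℕ.+ 2) t k) ⟩
    C ℕ.* ((j ℕ.+ 2) ^ k ℕ.* t ^ k) ℕ.* suc d       ≡⟨ lemma C ((j ℕ.+ 2) ^ k) (t ^ k) (suc d) ⟩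
    A ℕ.* t ^ k                                     <⟨ ℕP.*-monoˡ-< (t ^ k) {{ℕ.>-nonZero (ℕP.m^n>0 t k)}} (ℕP.n<1+n A) ⟩
    N                                               <⟨ ℕP.n<1+n N ⟩
    suc N                                           ∎
    where
    open ℕP.≤-Reasoning
    lemma : ∀ C a b d → C ℕ.* (a ℕ.* b) ℕ.* d ≡ C ℕ.* a ℕ.* d ℕ.* b
    lemma = solve-∀

increasing-squeeze⇒ConvergesTo : ∀ (P : ℕ → ℚ) V (D : ℕ → ℚ) →
  (∀ {N M} → N ℕ.≤ M → P N ≤ P M) → (∀ M → P M ≤ V) → (∀ N → V ≤ P N + D N) →
  (∀ ε → 0ℚ < ε → Σ ℕ (λ N → D N < ε)) → ConvergesTo P V
increasing-squeeze⇒ConvergesTo P V D mono upper lower small ε 0<ε =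
  N₀ , λ M N₀≤M → ℚP.≤-<-trans (bound M N₀≤M) (proj₂ (small ε 0<ε))
  where
  N₀ = proj₁ (small ε 0<ε)
  bound : ∀ M → N₀ ℕ.≤ M → ∣ P M - V ∣ ≤ D N₀
  bound M N₀≤M = begin
    ∣ P M - V ∣          ≡⟨ cong ∣_∣ (solve 2 (λ x y → x :- y := :- (y :- x)) refl (P M) V) ⟩
    ∣ - (V - P M) ∣      ≡⟨ ℚP.∣-p∣≡∣p∣ (V - P M) ⟩
    ∣ V - P M ∣          ≡⟨ ℚP.0≤p⇒∣p∣≡p (ℚP.≤-trans (ℚP.≤-reflexive (sym (ℚP.+-inverseʳ (P M)))) (ℚP.+-monoˡ-≤ (- P M) (upper M))) ⟩
    V - P M              ≤⟨ ℚP.+-monoʳ-≤ V (ℚP.neg-antimono-≤ (mono N₀≤M)) ⟩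
    V - P N₀             ≤⟨ ℚP.+-monoˡ-≤ (- P N₀) (lower N₀) ⟩
    (P N₀ + D N₀) - P N₀ ≡⟨ solve 2 (λ x y → (x :+ y) :- x := y) refl (P N₀) (D N₀) ⟩
    D N₀                 ∎
    where open ℚP.≤-Reasoning

-- Sums over compositions

Σℚ-++ : ∀ {A : Set} (F : A → ℚ) xs ys → Σℚ (map F (xs ++ ys)) ≡ Σℚ (map F xs) + Σℚ (map F ys)
Σℚ-++ F [] ys = sym (ℚP.+-identityˡ _)
Σℚ-++ F (x ∷ xs) ys = trans (cong (F x +_) (Σℚ-++ F xs ys)) (sym (ℚP.+-assoc (F x) _ _))

Σℚ-concatMap : ∀ {A B : Set} (F : B → ℚ) (h : A → List B) xs →
  Σℚ (map F (concatMap h xs)) ≡ Σℚ (map (λ x → Σℚ (map F (h x))) xs)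
Σℚ-concatMap F h [] = refl
Σℚ-concatMap F h (x ∷ xs) = trans (Σℚ-++ F (h x) (concatMap h xs)) (cong (Σℚ (map F (h x)) +_) (Σℚ-concatMap F h xs))

Σℚ-cong : ∀ {A : Set} {f g : A → ℚ} {xs} → All (λ x → f x ≡ g x) xs → Σℚ (map f xs) ≡ Σℚ (map g xs)
Σℚ-cong [] = refl
Σℚ-cong (p ∷ ps) = cong₂ _+_ p (Σℚ-cong ps)

Σℚ-mono-≤ : ∀ {A : Set} {f g : A → ℚ} {xs} → All (λ x → f x ≤ g x) xs → Σℚ (map f xs) ≤ Σℚ (map g xs)
Σℚ-mono-≤ [] = ℚP.≤-refl
Σℚ-mono-≤ (p ∷ ps) = ℚP.+-mono-≤ p (Σℚ-mono-≤ ps)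

Σℚ-*ˡ : ∀ {A : Set} (f : A → ℚ) c xs → Σℚ (map (λ x → c * f x) xs) ≡ c * Σℚ (map f xs)
Σℚ-*ˡ f c [] = sym (ℚP.*-zeroʳ c)
Σℚ-*ˡ f c (x ∷ xs) = trans (cong (c * f x +_) (Σℚ-*ˡ f c xs)) (sym (ℚP.*-distribˡ-+ c (f x) _))

Σℚ-+ : ∀ {A : Set} (f g : A → ℚ) xs → Σℚ (map (λ x → f x + g x) xs) ≡ Σℚ (map f xs) + Σℚ (map g xs)
Σℚ-+ f g [] = refl
Σℚ-+ f g (x ∷ xs) = trans (cong (f x + g x +_) (Σℚ-+ f g xs))
  (solve 4 (λ x y z w → (x :+ y) :+ (z :+ w) := (x :+ z) :+ (y :+ w)) refl (f x) (g x) _ _)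

Σℚ-const : ∀ {A : Set} c (xs : List A) → Σℚ (map (λ _ → c) xs) ≡ fromℕ (length xs) * c
Σℚ-const c [] = sym (ℚP.*-zeroˡ c)
Σℚ-const c (x ∷ xs) = trans (cong (c +_) (Σℚ-const c xs))
  (trans (solve 2 (λ c l → c :+ l :* c := (con 1ℚ :+ l) :* c) refl c (fromℕ (length xs)))
    (cong (_* c) (sym (fromℕ-+ 1 (length xs)))))

Σℚ-comps-suc : ∀ (F : List ℕ → ℚ) k R → Σℚ (map F (comps (suc k) R))
  ≡ sumRange (λ a → Σℚ (map (λ αs → F (a ∷ αs)) (comps k (R ∸ a)))) 0 R
Σℚ-comps-suc F k R = trans (Σℚ-concatMap F (λ a → map (a ∷_) (comps k (R ∸ a))) (range 0 R))
  (trans (cong Σℚ (map-cong (λ a → cong Σℚ (sym (map-∘ (comps k (R ∸ a))))) (range 0 R)))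
         (Σℚ-range (λ a → Σℚ (map (λ αs → F (a ∷ αs)) (comps k (R ∸ a)))) 0 R))

comps-sum-length : ∀ k R → All (λ αs → sumℕ αs ≡ R × length αs ≡ k) (comps k R)
comps-sum-length zero zero = (refl , refl) ∷ []
comps-sum-length zero (suc R) = []
comps-sum-length (suc k) R = AllP.concat⁺ (AllP.map⁺ (AllP.map⁺ (AllP.applyUpTo⁺₁ (λ i → i) (suc R)
  (λ {a} a≤R → AllP.map⁺ (All.map (λ {αs} (sum≡ , len≡) → trans (cong (a ℕ.+_) sum≡) (ℕP.m+[n∸m]≡n (ℕP.≤-pred a≤R)) , cong suc len≡)
                                   (comps-sum-length k (R ∸ a)))))))

-- The middle expression as a truncated ζ⋆-value

weightSum : ℕ → ℕ → ℕ → ℚ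
weightSum s k R = Σℚ (map (λ αs → recipℕ (prodSuf s αs)) (comps k R))

weightSum-suc : ∀ s k R → weightSum s (suc k) R ≡ recipℕ (s ℕ.+ 1 ℕ.+ R) * sumRange (weightSum s k) 0 R
weightSum-suc s k R = begin
  weightSum s (suc k) R
    ≡⟨ Σℚ-comps-suc (λ αs → recipℕ (prodSuf s αs)) k R ⟩
  sumRange (λ a → Σℚ (map (λ αs → recipℕ ((s ℕ.+ 1 ℕ.+ a ℕ.+ sumℕ αs) ℕ.* prodSuf s αs)) (comps k (R ∸ a)))) 0 R
    ≡⟨ sumRange-cong 0 R (λ a _ a≤R → Σℚ-cong (All.map (λ {αs} (sum≡ , _) → first-factor a αs a≤R sum≡) (comps-sum-length k (R ∸ a)))) ⟩
  sumRange (λ a → Σℚ (map (λ αs → c * recipℕ (prodSuf s αs)) (comps k (R ∸ a)))) 0 R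
    ≡⟨ sumRange-cong 0 R (λ a _ _ → Σℚ-*ˡ (λ αs → recipℕ (prodSuf s αs)) c (comps k (R ∸ a))) ⟩
  sumRange (λ a → c * weightSum s k (R ∸ a)) 0 R
    ≡⟨ sumRange-*ˡ (λ a → weightSum s k (R ∸ a)) c 0 R ⟩
  c * sumRange (λ a → weightSum s k (R ∸ a)) 0 R
    ≡⟨ cong (c *_) (sumFrom-reverse (weightSum s k) R) ⟩
  c * sumRange (weightSum s k) 0 R ∎
  where
  open ≡-Reasoning
  c = recipℕ (s ℕ.+ 1 ℕ.+ R)
  first-factor : ∀ a αs → a ℕ.≤ R → sumℕ αs ≡ R ∸ a →
    recipℕ ((s ℕ.+ 1 ℕ.+ a ℕ.+ sumℕ αs) ℕ.* prodSuf s αs) ≡ c * recipℕ (prodSuf s αs)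
  first-factor a αs a≤R sum≡ = trans (cong (λ z → recipℕ (z ℕ.* prodSuf s αs)) total) (recipℕ-* (s ℕ.+ 1 ℕ.+ R) (prodSuf s αs))
    where
    total : s ℕ.+ 1 ℕ.+ a ℕ.+ sumℕ αs ≡ s ℕ.+ 1 ℕ.+ R
    total = trans (cong (s ℕ.+ 1 ℕ.+ a ℕ.+_) sum≡)
              (trans (ℕP.+-assoc (s ℕ.+ 1) a (R ∸ a)) (cong (s ℕ.+ 1 ℕ.+_) (ℕP.m+[n∸m]≡n a≤R)))

zsT-suc : ∀ m l n s → zsT (suc m) l n s ≡ sumRange (λ k → recipℕ (k ℕ.+ s) * zsT m k n s) l n
zsT-suc m l n s = Σℚ-range _ l n

zsT-suc-last : ∀ m l n s → zsT (suc m) l n s ≡ sumRange (λ k → recipℕ (k ℕ.+ s) * zsT m l k s) l n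
zsT-suc-last zero l n s = zsT-suc zero l n s
zsT-suc-last (suc m) l n s = begin
  zsT (suc (suc m)) l n s                              ≡⟨ zsT-suc (suc m) l n s ⟩
  sumRange (λ k → f k * zsT (suc m) k n s) l n         ≡⟨ sumRange-cong l n (λ k _ _ → cong (f k *_) (zsT-suc-last m k n s)) ⟩
  sumRange (λ k → f k * sumRange (λ j → f j * zsT m k j s) k n) l n
    ≡⟨ sumRange-cong l n (λ k _ _ → sym (sumRange-*ˡ (λ j → f j * zsT m k j s) (f k) k n)) ⟩
  sumRange (λ k → sumRange (G k) k n) l n              ≡⟨ sumRange-triangle G l n ⟩
  sumRange (λ j → sumRange (λ k → G k j) l j) l n
    ≡⟨ sumRange-cong l n (λ j _ _ → trans (sumRange-cong l j (λ k _ _ → solve 3 (λ a b z → a :* (b :* z) := b :* (a :* z)) refl (f k) (f j) (zsT m k j s)))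
                                          (sumRange-*ˡ (λ k → f k * zsT m k j s) (f j) l j)) ⟩
  sumRange (λ j → f j * sumRange (λ k → f k * zsT m k j s) l j) l n
    ≡⟨ sumRange-cong l n (λ j _ _ → cong (f j *_) (sym (zsT-suc m l j s))) ⟩
  sumRange (λ j → f j * zsT (suc m) l j s) l n         ∎
  where
  open ≡-Reasoning
  f : ℕ → ℚ
  f k = recipℕ (k ℕ.+ s)
  G : ℕ → ℕ → ℚ
  G k j = f k * (f j * zsT m k j s)

sumRange-weightSum : ∀ s q r → sumRange (weightSum s q) 0 r ≡ zsT q 1 (suc r) s
sumRange-weightSum s zero r = begin
  sumRange (weightSum s 0) 0 r                   ≡⟨ sumRange-cons (weightSum s 0) 0 r z≤n ⟩
  weightSum s 0 0 + sumRange (weightSum s 0) 1 r ≡⟨ cong₂ _+_ (ℚP.+-identityʳ 1ℚ) (sumRange-cong 1 r (λ { (suc i) _ _ → refl })) ⟩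
  1ℚ + sumRange (λ _ → 0ℚ) 1 r                   ≡⟨ cong (1ℚ +_) (trans (sumFrom-const 0ℚ 1 (suc r ∸ 1)) (ℚP.*-zeroʳ (fromℕ (suc r ∸ 1)))) ⟩
  1ℚ + 0ℚ                                        ≡⟨ ℚP.+-identityʳ 1ℚ ⟩
  1ℚ                                             ∎
  where open ≡-Reasoning
sumRange-weightSum s (suc q) r = begin
  sumRange (weightSum s (suc q)) 0 r
    ≡⟨ sumRange-cong 0 r (λ j _ _ → trans (weightSum-suc s q j) (cong (recipℕ (s ℕ.+ 1 ℕ.+ j) *_) (sumRange-weightSum s q j))) ⟩
  sumRange (λ j → recipℕ (s ℕ.+ 1 ℕ.+ j) * zsT q 1 (suc j) s) 0 r
    ≡⟨ sumRange-cong 0 r (λ j _ _ → cong (λ z → recipℕ z * zsT q 1 (suc j) s) (lemma s j)) ⟩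
  sumRange (λ j → recipℕ (suc j ℕ.+ s) * zsT q 1 (suc j) s) 0 r
    ≡⟨ sym (sumFrom-shift (λ k → recipℕ (k ℕ.+ s) * zsT q 1 k s) 0 (suc r)) ⟩
  sumRange (λ k → recipℕ (k ℕ.+ s) * zsT q 1 k s) 1 (suc r)
    ≡⟨ sym (zsT-suc-last q 1 (suc r) s) ⟩
  zsT (suc q) 1 (suc r) s ∎
  where
  open ≡-Reasoning
  lemma : ∀ s j → s ℕ.+ 1 ℕ.+ j ≡ suc j ℕ.+ s
  lemma = solve-∀

middle≡zetaStar : ∀ r s q → recipℕ ((r ℕ.+ s ℕ.+ 1) !) * weightSum s (suc q) r
  ≡ zetaStar (suc r) q s * recipℕ ((r ℕ.+ s ℕ.+ 1) ℕ.* (r ℕ.+ s ℕ.+ 1) !)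
middle≡zetaStar r s q = begin
  F * weightSum s (suc q) r                             ≡⟨ cong (F *_) (weightSum-suc s q r) ⟩
  F * (recipℕ (s ℕ.+ 1 ℕ.+ r) * sumRange (weightSum s q) 0 r)
    ≡⟨ cong₂ (λ a z → F * (recipℕ a * z)) (lemma s r) (sumRange-weightSum s q r) ⟩
  F * (recipℕ (r ℕ.+ s ℕ.+ 1) * Z)                      ≡⟨ solve 3 (λ f a z → f :* (a :* z) := z :* (a :* f)) refl F (recipℕ (r ℕ.+ s ℕ.+ 1)) Z ⟩
  Z * (recipℕ (r ℕ.+ s ℕ.+ 1) * F)                      ≡⟨ cong (Z *_) (sym (recipℕ-* (r ℕ.+ s ℕ.+ 1) _)) ⟩
  Z * recipℕ ((r ℕ.+ s ℕ.+ 1) ℕ.* (r ℕ.+ s ℕ.+ 1) !)    ∎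
  where
  open ≡-Reasoning
  F = recipℕ ((r ℕ.+ s ℕ.+ 1) !)
  Z = zsT q 1 (suc r) s
  lemma : ∀ s r → s ℕ.+ 1 ℕ.+ r ≡ r ℕ.+ s ℕ.+ 1
  lemma = solve-∀

Σℚ-≤-+const : ∀ {A : Set} {f g : A → ℚ} c {xs : List A} → All (λ x → f x ≤ g x + c) xs →
  Σℚ (map f xs) ≤ Σℚ (map g xs) + fromℕ (length xs) * c
Σℚ-≤-+const {f = f} {g} c {xs} f≤g+c = begin
  Σℚ (map f xs)                              ≤⟨ Σℚ-mono-≤ f≤g+c ⟩
  Σℚ (map (λ x → g x + c) xs)                ≡⟨ Σℚ-+ g (λ _ → c) xs ⟩
  Σℚ (map g xs) + Σℚ (map (λ _ → c) xs)      ≡⟨ cong (Σℚ (map g xs) +_) (Σℚ-const c xs) ⟩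
  Σℚ (map g xs) + fromℕ (length xs) * c      ∎
  where open ℚP.≤-Reasoning

sumℕ-bumpLast : ∀ t a as → sumℕ (bumpLast t (a ∷ as)) ≡ sumℕ (a ∷ as) ℕ.+ t
sumℕ-bumpLast t a [] = lemma a t
  where
  lemma : ∀ a t → a ℕ.+ t ℕ.+ 0 ≡ a ℕ.+ 0 ℕ.+ t
  lemma = solve-∀
sumℕ-bumpLast t a (b ∷ as) = trans (cong (a ℕ.+_) (sumℕ-bumpLast t b as)) (sym (ℕP.+-assoc a _ t))

length-bumpLast : ∀ t a as → length (bumpLast t (a ∷ as)) ≡ length (a ∷ as)
length-bumpLast t a [] = refl
length-bumpLast t a (b ∷ as) = cong suc (length-bumpLast t b as)

bumpLast-positiveSuffixSums : ∀ t a as → 1 ℕ.≤ t → PositiveSuffixSums (bumpLast t (a ∷ as))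
bumpLast-positiveSuffixSums t a [] 1≤t = ℕP.≤-trans 1≤t (ℕP.≤-trans (ℕP.m≤n+m t a) (ℕP.m≤m+n (a ℕ.+ t) 0)) ∷ []
bumpLast-positiveSuffixSums t a (b ∷ as) 1≤t =
  ℕP.≤-trans 1≤t (ℕP.≤-trans (ℕP.m≤n+m t (sumℕ (b ∷ as)))
    (subst (λ z → z ℕ.≤ a ℕ.+ sumℕ (bumpLast t (b ∷ as))) (sumℕ-bumpLast t b as) (ℕP.m≤n+m _ a)))
  ∷ bumpLast-positiveSuffixSums t b as 1≤t

suffixSumProd-bumpLast : ∀ s a as → suffixSumProd (bumpLast (s ℕ.+ 1) (a ∷ as)) ≡ prodSuf s (a ∷ as)
suffixSumProd-bumpLast s a [] = lemma a s
  where
  lemma : ∀ a s → (a ℕ.+ (s ℕ.+ 1) ℕ.+ 0) ℕ.* 1 ≡ (s ℕ.+ 1 ℕ.+ a ℕ.+ 0) ℕ.* 1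
  lemma = solve-∀
suffixSumProd-bumpLast s a (b ∷ as) =
  cong₂ ℕ._*_ (trans (cong (a ℕ.+_) (sumℕ-bumpLast (s ℕ.+ 1) b as)) (lemma a (sumℕ (b ∷ as)) s))
              (suffixSumProd-bumpLast s b as)
  where
  lemma : ∀ a x s → a ℕ.+ (x ℕ.+ (s ℕ.+ 1)) ≡ s ℕ.+ 1 ℕ.+ a ℕ.+ x
  lemma = solve-∀

BumpedComposition : ℕ → ℕ → ℕ → List ℕ → Set
BumpedComposition s q r α =
  PositiveSuffixSums (bumpLast (s ℕ.+ 1) α) × length (bumpLast (s ℕ.+ 1) α) ≡ suc q
  × rhoLimit (bumpLast (s ℕ.+ 1) α) 0 0 ≡ recipℕ ((r ℕ.+ s ℕ.+ 1) !) * recipℕ (prodSuf s α)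

bumpedComposition : ∀ s q r α → sumℕ α ≡ r → length α ≡ suc q → BumpedComposition s q r α
bumpedComposition s q r (a ∷ as) sum≡ len≡ =
  bumpLast-positiveSuffixSums (s ℕ.+ 1) a as (ℕP.m≤n+m 1 s) ,
  trans (length-bumpLast (s ℕ.+ 1) a as) len≡ ,
  (begin
    recipℕ (suffixSumProd (bumpLast (s ℕ.+ 1) (a ∷ as))) * recipℕ (rf 1 (sumℕ (bumpLast (s ℕ.+ 1) (a ∷ as))))
      ≡⟨ cong₂ (λ u v → recipℕ u * recipℕ (rf 1 v)) (suffixSumProd-bumpLast s a as) total ⟩
    recipℕ (prodSuf s (a ∷ as)) * recipℕ (rf 1 (r ℕ.+ s ℕ.+ 1))
      ≡⟨ cong (λ z → recipℕ (prodSuf s (a ∷ as)) * recipℕ z) (rf-1≡! (r ℕ.+ s ℕ.+ 1)) ⟩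
    recipℕ (prodSuf s (a ∷ as)) * recipℕ ((r ℕ.+ s ℕ.+ 1) !)
      ≡⟨ ℚP.*-comm (recipℕ (prodSuf s (a ∷ as))) _ ⟩
    recipℕ ((r ℕ.+ s ℕ.+ 1) !) * recipℕ (prodSuf s (a ∷ as)) ∎)
  where
  open ≡-Reasoning
  total : sumℕ (bumpLast (s ℕ.+ 1) (a ∷ as)) ≡ r ℕ.+ s ℕ.+ 1
  total = trans (sumℕ-bumpLast (s ℕ.+ 1) a as) (trans (cong (ℕ._+ (s ℕ.+ 1)) sum≡) (sym (ℕP.+-assoc r s 1)))

bumpedCompositions : ∀ s q r → All (BumpedComposition s q r) (comps (suc q) r)
bumpedCompositions s q r = All.map (λ {α} (sum≡ , len≡) → bumpedComposition s q r α sum≡ len≡) (comps-sum-length (suc q) r)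

corollary2p3 : (r s q : ℕ) →
    ConvergesTo
    (λ N → Σℚ (map (λ αs → rhoPartial (bumpLast (s ℕ.+ 1) αs) N) (comps (suc q) r)))
    (recipℕ ((r ℕ.+ s ℕ.+ 1) !) * Σℚ (map (λ αs → recipℕ (prodSuf s αs)) (comps (suc q) r)))
    × (recipℕ ((r ℕ.+ s ℕ.+ 1) !) * Σℚ (map (λ αs → recipℕ (prodSuf s αs)) (comps (suc q) r))
    ≡ zetaStar (suc r) q s * recipℕ ((r ℕ.+ s ℕ.+ 1) ℕ.* (r ℕ.+ s ℕ.+ 1) !))
corollary2p3 r s q =
  increasing-squeeze⇒ConvergesTo P V (λ N → fromℕ (length L) * errorBound (suc q) N) mono upper lower
    (errorBound-small (length L) (suc q)) ,
  middle≡zetaStar r s q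
  where
  L = comps (suc q) r
  β = bumpLast (s ℕ.+ 1)
  P : ℕ → ℚ
  P N = Σℚ (map (λ α → rhoPartial (β α) N) L)
  V = recipℕ ((r ℕ.+ s ℕ.+ 1) !) * weightSum s (suc q) r
  V≡Σ : V ≡ Σℚ (map (λ α → rhoLimit (β α) 0 0) L)
  V≡Σ = trans (sym (Σℚ-*ˡ (λ α → recipℕ (prodSuf s α)) (recipℕ ((r ℕ.+ s ℕ.+ 1) !)) L))
              (Σℚ-cong (All.map (λ (_ , _ , lim≡) → sym lim≡) (bumpedCompositions s q r)))
  mono : ∀ {N M} → N ℕ.≤ M → P N ≤ P M
  mono N≤M = Σℚ-mono-≤ (All.tabulate {xs = L} (λ {α} _ → rhoT-monoʳ-≤ (β α) 0 0 _ _ N≤M))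
  upper : ∀ M → P M ≤ V
  upper M = ℚP.≤-trans (Σℚ-mono-≤ (All.map (λ {α} (pos , _ , _) → rhoT≤rhoLimit (β α) pos 0 0 M z≤n) (bumpedCompositions s q r)))
                       (ℚP.≤-reflexive (sym V≡Σ))
  lower : ∀ N → V ≤ P N + fromℕ (length L) * errorBound (suc q) N
  lower N = subst (_≤ P N + _) (sym V≡Σ) (Σℚ-≤-+const (errorBound (suc q) N)
    (All.map (λ {α} (pos , len≡ , _) → subst (λ k → rhoLimit (β α) 0 0 ≤ rhoPartial (β α) N + errorBound k N) len≡
                                         (rhoLimit≤rhoT+errorBound (β α) pos 0 0 N z≤n))
             (bumpedCompositions s q r)))
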